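{- Let $k\ge s\ge 3$ and $n\ge k+1$ be integers. Let $G$ be a $2$-connected graph on $n$ vertices with $N_s(G)=g_s(n,k)$, and let $u$ be a vertex of $G$ with two distinct neighbours $v,x$ such that $c_{uv}(G)\le k$ and $N_G(u)\cap N_G(x)=\emptyset$. Suppose $N_s(G/ux)=N_s(G)$ and $M(G/ux,uv)=X_{n-1,k}$. Then $\{u,v\}$ is a $2$-vertex cut of $G$.
   Context: All graphs are finite and simple; equality of graphs means isomorphism. $N_s(G)$ is the number of $s$-cliques of $G$; $N_G(w)$ is the neighbourhood of $w$. For an edge $e$, $c_e(G)$ is the maximum length of a cycle of $G$ containing $e$. $G/ux$ is the graph obtained by contracting the edge $ux$, the resulting vertex being called $u$. For integers $m,k$, let $\beta=\lfloor (m-2)/(k-2)\rfloor$, $q=m-2-\beta(k-2)$ and $X_{m,k}=K_2\vee(\beta K_{k-2}+K_q)$ (join of $K_2$ with the disjoint union of $\beta$ copies of $K_{k-2}$ and one $K_q$); $g_s(m,k)$ is the number of $s$-cliques of $X_{m,k}$, i.e. $\beta\binom{k}{s}+\binom{q+2}{s}$ for $s\ge3$. For a graph $H$ with an edge $uv$ and $c_{uv}(H)\le k$, $M(H,uv)$ denotes an edge-maximal graph with respect to $H$ and $uv$: a graph on $V(H)$ containing $H$ as a spanning subgraph with $c_{uv}(M(H,uv))\le k$ and $c_{uv}(M(H,uv)+f)>k$ for every non-edge $f$ of $M(H,uv)$. -}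

module Defs where

open import Data.Bool using (Bool; true; false; not; _∧_; _∨_; if_then_else_)
open import Data.Bool.Properties using (∨-comm)
open import Data.Bool.ListAction using (and)
open import Data.Nat using (ℕ; zero; suc; _∸_; _≤_; _<ᵇ_; _≡ᵇ_; _+_)
open import Data.Nat.DivMod using (_/_)
open import Data.Fin using (Fin; toℕ; punchIn)
open import Data.Fin.Properties using (_≟_)
open import Data.Fin.Subset using (Subset; _∈_; ∣_∣)
open import Data.Vec using (Vec; []; _∷_; lookup)
open import Data.List using (List; []; _∷_; _++_; map; filterᵇ; length; allFin; concatMap)
open import Data.List.Relation.Unary.Linked using (Linked)
open import Data.List.Relation.Unary.Unique.Propositional using (Unique)
open import Data.Product using (Σ; ∃; _×_; _,_)
open import Data.Empty using (⊥)
open import Function.Bundles using (_↔_; Inverse)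
open import Relation.Nullary using (¬_; yes; no)
open import Relation.Nullary.Decidable using (⌊_⌋)
open import Relation.Binary.PropositionalEquality using (_≡_; _≢_; refl; cong)

record Graph (n : ℕ) : Set where
  field
    adj   : Fin n → Fin n → Bool
    sym   : ∀ i j → adj i j ≡ adj j i
    irrefl : ∀ i → adj i i ≡ false

open Graph public

Adj : ∀ {n} → Graph n → Fin n → Fin n → Set
Adj G i j = adj G i j ≡ true

mkGraph : ∀ {n} → (Fin n → Fin n → Bool) → Graph n
mkGraph {n} r = record { adj = a ; sym = s ; irrefl = ir }
  where
  a : Fin n → Fin n → Bool
  a i j = not ⌊ i ≟ j ⌋ ∧ (r i j ∨ r j i)
  s : ∀ i j → a i j ≡ a j i
  s i j with i ≟ j | j ≟ i
  ... | yes _ | yes _ = refl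
  ... | yes p | no q = Data.Empty.⊥-elim (q (Relation.Binary.PropositionalEquality.sym p))
  ... | no q | yes p = Data.Empty.⊥-elim (q (Relation.Binary.PropositionalEquality.sym p))
  ... | no _ | no _ = ∨-comm (r i j) (r j i)
  ir : ∀ i → a i i ≡ false
  ir i with i ≟ i
  ... | yes _ = refl
  ... | no q = Data.Empty.⊥-elim (q refl)

subsets : ∀ n → List (Subset n)
subsets zero = [] ∷ []
subsets (suc n) = concatMap (λ S → (false ∷ S) ∷ (true ∷ S) ∷ []) (subsets n)

isClique : ∀ {n} → Graph n → Subset n → Bool
isClique {n} G S =
  and (map (λ i → and (map (λ j → not (lookup S i ∧ lookup S j ∧ not ⌊ i ≟ j ⌋) ∨ adj G i j)
                           (allFin n)))
           (allFin n))

N : ℕ → ∀ {n} → Graph n → ℕ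
N s {n} G = length (filterᵇ (λ S → ⌊ Data.Nat._≟_ ∣ S ∣ s ⌋ ∧ isClique G S) (subsets n))
  where import Data.Nat

-- Reach G P a b : there is a walk from a to b in G all of whose vertices
-- after the first satisfy P (so, when P a holds, a walk inside the
-- subgraph induced by P).
data Reach {n} (G : Graph n) (P : Fin n → Set) : Fin n → Fin n → Set where
  here : ∀ {a} → Reach G P a a
  step : ∀ {a b c} → Adj G a c → P c → Reach G P c b → Reach G P a b

TwoConnected : ∀ {n} → Graph n → Set
TwoConnected {n} G =
  (3 ≤ n) × (∀ w a b → a ≢ w → b ≢ w → Reach G (λ c → c ≢ w) a b)

IsVertexCut2 : ∀ {n} → Graph n → Fin n → Fin n → Set
IsVertexCut2 {n} G u v =
  Σ (Fin n) λ a → Σ (Fin n) λ b →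
    (a ≢ u) × (a ≢ v) × (b ≢ u) × (b ≢ v) ×
    ¬ Reach G (λ c → (c ≢ u) × (c ≢ v)) a b

-- c_{uv}(G) ≤ k : every cycle of G through the edge uv has length ≤ k.
-- Such a cycle is  v , w₁ , … , wₜ , u  (t ≥ 1, all distinct, consecutive
-- vertices adjacent) closed by the edge uv; its length is t + 2.

CycleBound : ∀ {n} → Graph n → Fin n → Fin n → ℕ → Set
CycleBound {n} G u v k =
  ∀ (mid : List (Fin n)) → mid ≢ [] →
    Linked (Adj G) (v ∷ mid ++ u ∷ []) →
    Unique (v ∷ mid ++ u ∷ []) →
    length mid + 2 ≤ k

-- Contraction G/ux.  Vertices of G/ux are the vertices of G other than x,
-- indexed by Fin m via punchIn x; the merged vertex is the one whose image
-- is u.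

Contract : ∀ {m} → Graph (suc m) → Fin (suc m) → Fin (suc m) → Graph m
Contract G u x = mkGraph λ i j →
  adj G (punchIn x i) (punchIn x j) ∨
  (⌊ punchIn x i ≟ u ⌋ ∧ adj G x (punchIn x j))

AddEdge : ∀ {n} → Graph n → Fin n → Fin n → Graph n
AddEdge G i j = mkGraph λ a b → adj G a b ∨ (⌊ a ≟ i ⌋ ∧ ⌊ b ≟ j ⌋)

SpanningSub : ∀ {n} → Graph n → Graph n → Set
SpanningSub H M = ∀ i j → Adj H i j → Adj M i j

-- M is an edge-maximal graph with respect to H and uv (for the bound k),
-- i.e. M is a possible value of M(H,uv).
EdgeMaximal : ∀ {n} → Graph n → Fin n → Fin n → ℕ → Graph n → Set
EdgeMaximal {n} H u v k M =
  SpanningSub H M × CycleBound M u v k ×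
  (∀ (i j : Fin n) → i ≢ j → adj M i j ≡ false → ¬ CycleBound (AddEdge M i j) u v k)

_≅_ : ∀ {n} → Graph n → Graph n → Set
_≅_ {n} G H = Σ (Fin n ↔ Fin n) λ f →
  ∀ i j → adj H (Inverse.to f i) (Inverse.to f j) ≡ adj G i j

-- X_{m,k} = K₂ ∨ (β K_{k-2} + K_q) on vertex set Fin m:
-- vertices 0,1 form the K₂; a vertex i ≥ 2 lies in block ⌊(i-2)/(k-2)⌋,
-- giving β blocks of size k-2 and one final block of size q.
-- (k - 2 is written suc (k ∸ 3), which equals k - 2 for k ≥ 3.)

block : ℕ → ℕ → ℕ
block k i = (i ∸ 2) / suc (k ∸ 3)

X : (m k : ℕ) → Graph m
X m k = mkGraph λ i j →
  (toℕ i <ᵇ 2) ∨ (toℕ j <ᵇ 2) ∨ ⌊ Data.Nat._≟_ (block k (toℕ i)) (block k (toℕ j)) ⌋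
  where import Data.Nat

g : ℕ → ℕ → ℕ → ℕ
g s m k = N s (X m k)

-- Contracting ux loses no s-cliques, so N_s(G/ux) = g_s(n,k) ≥ g_s(n-1,k) = N_s(M), where
-- M = M(G/ux,uv) ≅ X_{n-1,k} contains G/ux.  Hence G/ux and M have the same s-cliques, and
-- since s ≤ k the k-clique of M formed by the K₂ and the first block of X is a clique of G/ux,
-- i.e. of G away from u.  Call it K.  If v ∈ K, x has no neighbour y ∈ K other than u, v:
-- otherwise v, K ∖ {u,v,y}, y, x, u is a cycle through uv with more than k vertices.
-- In X_{n-1,k} every edge except the K₂ edge lies on a cycle of length > k (through a
-- vertex outside the first k), so u and v are the K₂ of X.  If n - 1 = k this contradicts
-- 2-connectivity, as x then has a neighbour in K ∖ {u,v}; otherwise K ∖ {u,v} is closed under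
-- neighbours in G - {u,v} and does not contain x.

module Submission where

open import Defs hiding (sym)

open import Data.Bool using (Bool; true; false; T; not; _∧_; _∨_; if_then_else_)
open import Data.Bool.ListAction using (all)
open import Data.Bool.Properties using (T-≡; T-∧; T?; ∨-zeroʳ; ∧-zeroʳ)
open import Data.Empty using (⊥; ⊥-elim)
open import Data.Fin using (Fin; zero; suc; toℕ; inject₁; inject≤; fromℕ<; punchIn; punchOut)
open import Data.Fin.Permutation using (Permutation; _⟨$⟩ʳ_; flip)
open import Data.Fin.Properties
  using (_≟_; toℕ<n; toℕ-injective; toℕ-fromℕ<; toℕ-inject₁; inject₁-injective; toℕ-inject≤;
         inject≤-injective; punchIn-injective; punchInᵢ≢i; punchIn-punchOut)
open import Data.Fin.Subset using (Subset; ∣_∣; _∪_; ⁅_⁆) renaming (_∈_ to _∈ₛ_; _⊆_ to _⊆ₛ_)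
open import Data.Fin.Subset.Properties
  using (∣p∣≤∣x∷p∣; drop-∷-⊆; s⊆s; out⊆; x∈p∪q⁺; x∈p∪q⁻; x∈⁅x⁆; x∈⁅y⁆⇒x≡y; ∣⁅x⁆∣≡1)
open import Data.List
  using (List; []; _∷_; _++_; [_]; map; filter; filterᵇ; concatMap; tabulate; allFin; length; head; last;
         initLast; _∷ʳ′_)
open import Data.List.Membership.Propositional using (_∈_; _∉_)
open import Data.List.Membership.Propositional.Properties
  using (∈-++⁻; ∈-++⁺ˡ; ∈-++⁺ʳ; ∈-∃++; ∈-map⁺; ∈-map⁻; ∈-filter⁺; ∈-filter⁻; ∈-tabulate⁺; ∈-tabulate⁻; ∈-allFin)
open import Data.List.Properties
  using (length-++; length-map; length-tabulate; ++-assoc; map-++; filter-notAll)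
open import Data.List.Relation.Binary.Pointwise using (Pointwise-≡⇒≡)
open import Data.List.Relation.Binary.Sublist.Propositional using () renaming (_⊆_ to _⊑_; ⊆-refl to ⊑-refl)
open import Data.List.Relation.Binary.Sublist.Propositional.Properties
  using () renaming (filter⁺ to ⊑-filter⁺; length-mono-≤ to ⊑-length; to-≋ to ⊑⇒≋)
open import Data.List.Relation.Binary.Subset.Propositional using (_⊆_)
open import Data.List.Relation.Unary.All as All using (All; []; _∷_)
import Data.List.Relation.Unary.All.Properties as AllP
open import Data.List.Relation.Unary.AllPairs using ([]; _∷_)
open import Data.List.Relation.Unary.Any as Any using (Any; here; there)
open import Data.List.Relation.Unary.Linked as Linked using (Linked; []; [-]; _∷_)
import Data.List.Relation.Unary.Linked.Properties as Linked
open import Data.List.Relation.Unary.Unique.Propositional using (Unique)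
import Data.List.Relation.Unary.Unique.Propositional.Properties as Unique
open import Data.Maybe using (just)
open import Data.Nat using (ℕ; zero; suc; _+_; _∸_; _≤_; _<_; _<ᵇ_; _<?_; z≤n; s≤s)
import Data.Nat as ℕ
open import Data.Nat.DivMod using (m<n⇒m/n≡0; m/n≡0⇒m<n)
open import Data.Nat.Properties
  using (+-0-commutativeMonoid; +-assoc; +-comm; +-suc; +-monoˡ-≤; +-monoʳ-≤; +-monoʳ-<; +-cancelˡ-≤;
         ∸-monoˡ-≤; m≤n+m∸n; m+[n∸m]≡n; ≤-refl; ≤-reflexive; ≤-trans; ≤-antisym; <-≤-trans; <⇒≤;
         n≤1+n; n<1+n; n≤0⇒n≡0; <⇒≱; ≤⇒≯; ≮⇒≥; ≰⇒>; <⇒<ᵇ; <ᵇ⇒<; m≤n⇒m<n∨m≡n; _≤?_; module ≤-Reasoning)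
open import Data.Nat.Tactic.RingSolver using (solve-∀)
import Algebra.Properties.CommutativeMonoid.Sum +-0-commutativeMonoid as Σ
open import Data.Product using (∃; _×_; _,_; proj₁; proj₂; uncurry)
open import Data.Sum using (_⊎_; inj₁; inj₂)
open import Data.Vec using (lookup; []; _∷_; here; there)
import Data.Vec as Vec
open import Data.Vec.Properties
  using ([]=⇒lookup; lookup⇒[]=; lookup∘tabulate; tabulate∘lookup; tabulate-cong; ∷ʳ-injectiveˡ)
open import Function using (_∘_; id)
open import Function.Bundles using (Equivalence; Inverse)
open import Relation.Binary.Definitions using (DecidableEquality)
open import Relation.Binary.PropositionalEquality
  using (_≡_; _≢_; ≢-sym; refl; sym; trans; cong; cong₂; subst; subst₂; module ≡-Reasoning)
open import Relation.Nullary using (¬_; ¬?; yes; no; contradiction)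
open import Relation.Nullary.Decidable using (⌊_⌋; decidable-stable; toWitness; fromWitness)
open import Relation.Unary using (Decidable)

private variable A : Set

length-filter-∁ : {P : A → Set} (P? : Decidable P) (xs : List A) →
                  length (filter P? xs) + length (filter (¬? ∘ P?) xs) ≡ length xs
length-filter-∁ P? [] = refl
length-filter-∁ P? (x ∷ xs) with P? x
... | yes _ = cong suc (length-filter-∁ P? xs)
... | no _ = trans (+-suc _ _) (cong suc (length-filter-∁ P? xs))

Unique-⊆⇒length≤ : {xs ys : List A} → Unique xs → xs ⊆ ys → length xs ≤ length ys
Unique-⊆⇒length≤ {xs = []} _ _ = z≤n
Unique-⊆⇒length≤ {xs = x ∷ xs} (x∉xs ∷ xs!) x∷xs⊆ys with ∈-∃++ (x∷xs⊆ys (here refl))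
... | ys₁ , ys₂ , refl = begin
  suc (length xs)                 ≤⟨ s≤s (Unique-⊆⇒length≤ xs! xs⊆ys₁ys₂) ⟩
  suc (length (ys₁ ++ ys₂))       ≡⟨ cong suc (length-++ ys₁) ⟩
  suc (length ys₁ + length ys₂)   ≡⟨ +-suc (length ys₁) _ ⟨
  length ys₁ + length (x ∷ ys₂)   ≡⟨ length-++ ys₁ ⟨
  length (ys₁ ++ x ∷ ys₂)         ∎
  where
  open ≤-Reasoning
  xs⊆ys₁ys₂ : xs ⊆ ys₁ ++ ys₂
  xs⊆ys₁ys₂ {z} z∈xs with ∈-++⁻ ys₁ (x∷xs⊆ys (there z∈xs))
  ... | inj₁ z∈ys₁ = ∈-++⁺ˡ z∈ys₁
  ... | inj₂ (here refl) = contradiction refl (All.lookup x∉xs z∈xs)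
  ... | inj₂ (there z∈ys₂) = ∈-++⁺ʳ ys₁ z∈ys₂

Unique-++⁻ˡ : ∀ (xs : List A) {ys} → Unique (xs ++ ys) → Unique xs
Unique-++⁻ˡ [] _ = []
Unique-++⁻ˡ (x ∷ xs) (x∉ ∷ !) = AllP.++⁻ˡ xs x∉ ∷ Unique-++⁻ˡ xs !

Unique-++⁻ʳ : ∀ (xs : List A) {ys} → Unique (xs ++ ys) → Unique ys
Unique-++⁻ʳ [] ! = !
Unique-++⁻ʳ (x ∷ xs) (_ ∷ !) = Unique-++⁻ʳ xs !

Unique-insert : ∀ (xs : List A) {ys zs} → Unique (xs ++ ys) → Unique zs →
                (∀ {z} → z ∈ zs → z ∉ xs ++ ys) → Unique (xs ++ zs ++ ys)
Unique-insert [] ys! zs! fresh = Unique.++⁺ zs! ys! λ (z∈zs , z∈ys) → fresh z∈zs z∈ys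
Unique-insert (x ∷ xs) {ys} {zs} (x∉ ∷ !) zs! fresh =
  All.tabulate x≢ ∷ Unique-insert xs ! zs! (λ z∈zs → fresh z∈zs ∘ there)
  where
  x≢ : ∀ {z} → z ∈ xs ++ zs ++ ys → x ≢ z
  x≢ z∈ refl with ∈-++⁻ xs z∈
  ... | inj₁ x∈xs = All.lookup x∉ (∈-++⁺ˡ x∈xs) refl
  ... | inj₂ x∈zsys with ∈-++⁻ zs x∈zsys
  ...   | inj₁ x∈zs = fresh x∈zs (here refl)
  ...   | inj₂ x∈ys = All.lookup x∉ (∈-++⁺ʳ xs x∈ys) refl

module Difference {A : Set} (_≟_ : DecidableEquality A) where
  open import Data.List.Membership.DecPropositional _≟_ using (_∈?_; _∉?_)

  infixl 5 _∖_
  _∖_ : List A → List A → List A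
  xs ∖ ys = filter (_∉? ys) xs

  ∈-∖⁻ : ∀ {z} xs ys → z ∈ xs ∖ ys → z ∈ xs × z ∉ ys
  ∈-∖⁻ xs ys = ∈-filter⁻ (_∉? ys)

  ∖-unique : ∀ {xs} ys → Unique xs → Unique (xs ∖ ys)
  ∖-unique ys = Unique.filter⁺ (_∉? ys)

  length-∖ : ∀ {xs} ys → Unique xs → length xs ≤ length (xs ∖ ys) + length ys
  length-∖ {xs} ys xs! = begin
    length xs                                               ≡⟨ length-filter-∁ (_∉? ys) xs ⟨
    length (xs ∖ ys) + length (filter (¬? ∘ (_∉? ys)) xs)  ≤⟨ +-monoʳ-≤ (length (xs ∖ ys)) kept≤ys ⟩
    length (xs ∖ ys) + length ys                            ∎
    where
    open ≤-Reasoning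
    kept≤ys : length (filter (¬? ∘ (_∉? ys)) xs) ≤ length ys
    kept≤ys = Unique-⊆⇒length≤ (Unique.filter⁺ (¬? ∘ (_∉? ys)) xs!)
                (λ {z} z∈ → decidable-stable (z ∈? ys) (proj₂ (∈-filter⁻ (¬? ∘ (_∉? ys)) {xs = xs} z∈)))

head-++-∷ : ∀ (xs : List A) {y ys} → head (xs ++ y ∷ ys) ≡ head (xs ++ [ y ])
head-++-∷ [] = refl
head-++-∷ (x ∷ xs) = refl

last-++-∷ : ∀ (xs : List A) {y ys} → last (xs ++ y ∷ ys) ≡ last (y ∷ ys)
last-++-∷ [] = refl
last-++-∷ (x ∷ []) = refl
last-++-∷ (x ∷ x′ ∷ xs) = last-++-∷ (x′ ∷ xs)

module _ {R : A → A → Set} where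

  Linked-join : ∀ xs {y ys} → Linked R (xs ++ [ y ]) → Linked R (y ∷ ys) → Linked R (xs ++ y ∷ ys)
  Linked-join [] _ y∷ys = y∷ys
  Linked-join (x ∷ []) (r ∷ [-]) y∷ys = r ∷ y∷ys
  Linked-join (x ∷ x′ ∷ xs) (r ∷ rs) y∷ys = r ∷ Linked-join (x′ ∷ xs) rs y∷ys

  clique⇒Linked : (Q : A → Set) → (∀ {a b} → Q a → Q b → a ≢ b → R a b) →
                  ∀ {xs} → All Q xs → Unique xs → Linked R xs
  clique⇒Linked Q clique [] _ = []
  clique⇒Linked Q clique (_ ∷ []) _ = [-]
  clique⇒Linked Q clique (qa ∷ qb ∷ qs) ((a≢b ∷ _) ∷ !bs) =
    clique qa qb a≢b ∷ clique⇒Linked Q clique (qb ∷ qs) !bs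

module _ {n : ℕ} (G : Graph n) where

  Adj-sym : ∀ {a b} → Adj G a b → Adj G b a
  Adj-sym {a} {b} ab = trans (Graph.sym G b a) ab

  Adj⇒≢ : ∀ {a b} → Adj G a b → a ≢ b
  Adj⇒≢ {a} ab refl = contradiction (trans (sym ab) (irrefl G a)) λ ()

  -- A u–v path closes to a cycle through uv; 2 ≤ k covers the paths too short for that.
  path-length≤ : ∀ {u v k L} → 2 ≤ k → CycleBound G u v k →
                 Linked (Adj G) L → Unique L → head L ≡ just v → last L ≡ just u → length L ≤ k
  path-length≤ {u} {v} {k} {v ∷ rest} 2≤k bound linked unique refl lastu with initLast rest
  ... | [] = ≤-trans (s≤s z≤n) 2≤k
  ... | [] ∷ʳ′ u′ = 2≤k
  ... | (m ∷ mid) ∷ʳ′ u′ with trans (sym (last-++-∷ (v ∷ m ∷ mid))) lastu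
  ...   | refl = subst (_≤ k) length-cycle (bound (m ∷ mid) (λ ()) linked unique)
    where
    length-cycle : length (m ∷ mid) + 2 ≡ length (v ∷ m ∷ mid ++ [ u′ ])
    length-cycle = trans (cong suc (+-suc (length mid) 1)) (sym (length-++ (v ∷ m ∷ mid)))

  module _ (Q : Fin n → Set) (clique : ∀ {a b} → Q a → Q b → a ≢ b → Adj G a b) where
    open Difference (_≟_ {n})

    -- The path P, c, T ∖ E, d, R, where E contains every vertex of T among P, c, d, R.
    detour-through-clique :
      ∀ {u v k} → 2 ≤ k → CycleBound G u v k →
      ∀ {T} → Unique T → All Q T →
      ∀ P {c d} R E → Q c → Q d →
      Linked (Adj G) (P ++ [ c ]) → Linked (Adj G) (d ∷ R) → Unique (P ++ c ∷ d ∷ R) →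
      (∀ {z} → z ∈ T → z ∈ P ++ c ∷ d ∷ R → z ∈ E) →
      head (P ++ [ c ]) ≡ just v → last (d ∷ R) ≡ just u →
      length T + (length P + length R + 2) ≤ k + length E
    detour-through-clique {u} {v} {k} 2≤k bound {T} T! QT P {c} {d} R E Qc Qd
                          linkedP linkedR explicit! explicit∩T⊆E headv lastu = begin
      length T + (length P + length R + 2)              ≤⟨ +-monoˡ-≤ _ (length-∖ E T!) ⟩
      length K + length E + (length P + length R + 2)  ≡⟨ length-L ⟩
      length L + length E                               ≤⟨ +-monoˡ-≤ _ L≤k ⟩
      k + length E                                      ∎
      where
      open ≤-Reasoning
      K = T ∖ E
      L = P ++ c ∷ K ++ d ∷ R
      K-fresh : ∀ {z} → z ∈ K → z ∉ P ++ c ∷ d ∷ R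
      K-fresh z∈K z∈explicit with ∈-∖⁻ T E z∈K
      ... | z∈T , z∉E = z∉E (explicit∩T⊆E z∈T z∈explicit)
      L! : Unique L
      L! = subst Unique (++-assoc P [ c ] (K ++ d ∷ R))
             (Unique-insert (P ++ [ c ]) (subst Unique (sym (++-assoc P [ c ] (d ∷ R))) explicit!)
               (∖-unique E T!) (λ z∈K → K-fresh z∈K ∘ subst (_ ∈_) (++-assoc P [ c ] (d ∷ R))))
      run! : Unique (c ∷ K ++ [ d ])
      run! = Unique-++⁻ˡ (c ∷ K ++ [ d ]) (subst Unique (sym (++-assoc (c ∷ K) [ d ] R)) (Unique-++⁻ʳ P L!))
      run : Linked (Adj G) (c ∷ K ++ [ d ])
      run = clique⇒Linked Q clique
              (Qc ∷ AllP.++⁺ (All.tabulate (All.lookup QT ∘ proj₁ ∘ ∈-∖⁻ T E)) (Qd ∷ [])) run!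
      L-linked : Linked (Adj G) L
      L-linked = Linked-join P linkedP (Linked-join (c ∷ K) run linkedR)
      L-head : head L ≡ just v
      L-head = trans (head-++-∷ P) headv
      L-last : last L ≡ just u
      L-last = trans (last-++-∷ P) (trans (last-++-∷ (c ∷ K)) lastu)
      L≤k : length L ≤ k
      L≤k = path-length≤ 2≤k bound L-linked L! L-head L-last
      length-L : length K + length E + (length P + length R + 2) ≡ length L + length E
      length-L rewrite length-++ P {c ∷ K ++ d ∷ R} | length-++ K {d ∷ R} =
        rearrange (length K) (length E) (length P) (length R)
        where
        rearrange : ∀ a b p r → a + b + (p + r + 2) ≡ p + suc (a + suc r) + b
        rearrange = solve-∀

  Reach-invariant : ∀ {P : Fin n → Set} (I : Fin n → Set) → (∀ {c d} → I c → Adj G c d → P d → I d) →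
                    ∀ {a b} → Reach G P a b → I a → I b
  Reach-invariant I closed here Ia = Ia
  Reach-invariant I closed (step ac Pc cb) Ia = Reach-invariant I closed cb (closed Ia ac Pc)

  Reach⇒neighbour : ∀ {P : Fin n → Set} {a b} → Reach G P a b → a ≢ b → ∃ λ c → Adj G a c × P c
  Reach⇒neighbour here a≢b = contradiction refl a≢b
  Reach⇒neighbour (step ac Pc _) _ = _ , ac , Pc

IsClique : ∀ {n} → Graph n → Subset n → Set
IsClique G S = ∀ {i j} → i ∈ₛ S → j ∈ₛ S → i ≢ j → Adj G i j

module _ {n : ℕ} (G : Graph n) (S : Subset n) where

  private
    pairOK : Fin n → Fin n → Bool
    pairOK i j = not (lookup S i ∧ lookup S j ∧ not ⌊ i ≟ j ⌋) ∨ adj G i j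

  isClique⁻ : T (isClique G S) → IsClique G S
  isClique⁻ clique {i} {j} i∈S j∈S i≢j =
    Equivalence.to T-≡ (subst T (pairOK-member ([]=⇒lookup i∈S) ([]=⇒lookup j∈S)) pair-ok)
    where
    row : T (all (pairOK i) (allFin n))
    row = All.lookup (AllP.all⁺ _ (allFin n) clique) (∈-allFin i)
    pair-ok : T (pairOK i j)
    pair-ok = All.lookup (AllP.all⁺ (pairOK i) (allFin n) row) (∈-allFin j)
    pairOK-member : lookup S i ≡ true → lookup S j ≡ true → pairOK i j ≡ adj G i j
    pairOK-member Sᵢ Sⱼ rewrite Sᵢ | Sⱼ with i ≟ j
    ... | yes i≡j = contradiction i≡j i≢j
    ... | no _ = refl

  isClique⁺ : IsClique G S → T (isClique G S)
  isClique⁺ clique = AllP.all⁻ (λ i → all (pairOK i) (allFin n)) {allFin n}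
    (All.tabulate λ {i} _ → AllP.all⁻ (pairOK i) {allFin n} (All.tabulate λ {j} _ → pair i j))
    where
    pair : ∀ i j → T (pairOK i j)
    pair i j with lookup S i in Sᵢ | lookup S j in Sⱼ | i ≟ j
    ... | false | _ | _ = _
    ... | true | false | _ = _
    ... | true | true | yes _ = _
    ... | true | true | no i≢j =
      Equivalence.from T-≡ (clique (lookup⇒[]= i S Sᵢ) (lookup⇒[]= j S Sⱼ) i≢j)

private
  doubled : ∀ {n} → List (Subset n) → List (Subset (suc n))
  doubled = concatMap (λ S → (false ∷ S) ∷ (true ∷ S) ∷ [])

  ∈-doubled⁺ : ∀ {n} b {S : Subset n} {Ss} → S ∈ Ss → (b ∷ S) ∈ doubled Ss
  ∈-doubled⁺ false (here refl) = here refl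
  ∈-doubled⁺ true (here refl) = there (here refl)
  ∈-doubled⁺ b (there S∈Ss) = there (there (∈-doubled⁺ b S∈Ss))

  ∈-doubled⁻ : ∀ {n} {S′ : Subset (suc n)} Ss → S′ ∈ doubled Ss → Vec.tail S′ ∈ Ss
  ∈-doubled⁻ (S ∷ Ss) (here refl) = here refl
  ∈-doubled⁻ (S ∷ Ss) (there (here refl)) = here refl
  ∈-doubled⁻ (S ∷ Ss) (there (there S′∈)) = there (∈-doubled⁻ Ss S′∈)

  doubled-unique : ∀ {n} {Ss : List (Subset n)} → Unique Ss → Unique (doubled Ss)
  doubled-unique [] = []
  doubled-unique {Ss = S ∷ Ss} (S∉Ss ∷ Ss!) =
    ((λ ()) ∷ All.tabulate (tail-fresh false)) ∷ All.tabulate (tail-fresh true) ∷ doubled-unique Ss!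
    where
    tail-fresh : ∀ b {S′} → S′ ∈ doubled Ss → (b ∷ S) ≢ S′
    tail-fresh b S′∈ refl = All.lookup S∉Ss (∈-doubled⁻ Ss S′∈) refl

∈-subsets : ∀ {n} (S : Subset n) → S ∈ subsets n
∈-subsets [] = here refl
∈-subsets (b ∷ S) = ∈-doubled⁺ b (∈-subsets S)

subsets-unique : ∀ n → Unique (subsets n)
subsets-unique zero = [] ∷ []
subsets-unique (suc n) = doubled-unique (subsets-unique n)

isCliqueOfSize : ℕ → ∀ {n} → Graph n → Subset n → Bool
isCliqueOfSize s G S = ⌊ ∣ S ∣ ℕ.≟ s ⌋ ∧ isClique G S

-- N s G unfolds to length (cliques s G).
cliques : ℕ → ∀ {n} → Graph n → List (Subset n)
cliques s {n} G = filterᵇ (isCliqueOfSize s G) (subsets n)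

module _ (s : ℕ) {n : ℕ} (G : Graph n) where

  ∈-cliques⁺ : ∀ {S} → ∣ S ∣ ≡ s → IsClique G S → S ∈ cliques s G
  ∈-cliques⁺ {S} size clique =
    ∈-filter⁺ (T? ∘ isCliqueOfSize s G) (∈-subsets S)
      (Equivalence.from T-∧ (fromWitness size , isClique⁺ G S clique))

  ∈-cliques⁻ : ∀ {S} → S ∈ cliques s G → ∣ S ∣ ≡ s × IsClique G S
  ∈-cliques⁻ {S} S∈ with Equivalence.to T-∧ (proj₂ (∈-filter⁻ (T? ∘ isCliqueOfSize s G) {xs = subsets n} S∈))
  ... | size , clique = toWitness size , isClique⁻ G S clique

  cliques-unique : Unique (cliques s G)
  cliques-unique = Unique.filter⁺ (T? ∘ isCliqueOfSize s G) (subsets-unique n)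

module _ (s : ℕ) {m n : ℕ} {A : Graph m} {B : Graph n} where

  N-mono : (F : Subset m → Subset n) → (∀ {S S′} → F S ≡ F S′ → S ≡ S′) →
           (∀ {S} → ∣ S ∣ ≡ s → IsClique A S → ∣ F S ∣ ≡ s × IsClique B (F S)) →
           N s A ≤ N s B
  N-mono F F-injective F-clique = begin
    length (cliques s A)          ≡⟨ length-map F (cliques s A) ⟨
    length (map F (cliques s A))  ≤⟨ Unique-⊆⇒length≤ (Unique.map⁺ F-injective (cliques-unique s A)) F-image ⟩
    length (cliques s B)          ∎
    where
    open ≤-Reasoning
    F-image : map F (cliques s A) ⊆ cliques s B
    F-image S′∈ with ∈-map⁻ F S′∈
    ... | S , S∈ , refl = let size , clique = ∈-cliques⁻ s A S∈ in
                          uncurry (∈-cliques⁺ s B) (F-clique size clique)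

module _ (s : ℕ) {n : ℕ} {H M : Graph n} (H⊆M : SpanningSub H M) where

  spanning-cliques-shared : N s M ≤ N s H → ∀ {S} → ∣ S ∣ ≡ s → IsClique M S → IsClique H S
  spanning-cliques-shared M≤H {S} size clique =
    proj₂ (∈-cliques⁻ s H (subst (S ∈_) (sym cliques-equal) (∈-cliques⁺ s M size clique)))
    where
    H-cliques⊑M-cliques : cliques s H ⊑ cliques s M
    H-cliques⊑M-cliques = ⊑-filter⁺ (T? ∘ isCliqueOfSize s H) (T? ∘ isCliqueOfSize s M)
      (λ { {S′} refl T-H → let size , clique = Equivalence.to T-∧ T-H in
             Equivalence.from T-∧ (size , isClique⁺ M S′ λ i∈ j∈ i≢j →
               H⊆M _ _ (isClique⁻ H S′ clique i∈ j∈ i≢j)) })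
      (⊑-refl {x = subsets n})
    cliques-equal : cliques s H ≡ cliques s M
    cliques-equal = Pointwise-≡⇒≡ (⊑⇒≋ (≤-antisym (⊑-length H-cliques⊑M-cliques) M≤H) H-cliques⊑M-cliques)

∣p∪q∣≤∣p∣+∣q∣ : ∀ {n} (p q : Subset n) → ∣ p ∪ q ∣ ≤ ∣ p ∣ + ∣ q ∣
∣p∪q∣≤∣p∣+∣q∣ [] [] = z≤n
∣p∪q∣≤∣p∣+∣q∣ (false ∷ p) (false ∷ q) = ∣p∪q∣≤∣p∣+∣q∣ p q
∣p∪q∣≤∣p∣+∣q∣ (false ∷ p) (true ∷ q) =
  ≤-trans (s≤s (∣p∪q∣≤∣p∣+∣q∣ p q)) (≤-reflexive (sym (+-suc ∣ p ∣ ∣ q ∣)))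
∣p∪q∣≤∣p∣+∣q∣ (true ∷ p) (b ∷ q) =
  s≤s (≤-trans (∣p∪q∣≤∣p∣+∣q∣ p q) (+-monoʳ-≤ ∣ p ∣ (∣p∣≤∣x∷p∣ b q)))

⊆-between : ∀ {n} {A C : Subset n} t → A ⊆ₛ C → ∣ A ∣ ≤ t → t ≤ ∣ C ∣ →
            ∃ λ S → A ⊆ₛ S × S ⊆ₛ C × ∣ S ∣ ≡ t
⊆-between {A = []} {[]} t _ _ t≤0 = [] , id , id , sym (n≤0⇒n≡0 t≤0)
⊆-between {A = true ∷ A} {false ∷ C} t A⊆C _ _ with A⊆C here
... | ()
⊆-between {A = false ∷ A} {false ∷ C} t A⊆C A≤t t≤C with ⊆-between t (drop-∷-⊆ A⊆C) A≤t t≤C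
... | S , A⊆S , S⊆C , size = false ∷ S , s⊆s A⊆S , s⊆s S⊆C , size
⊆-between {A = true ∷ A} {true ∷ C} (suc t) A⊆C (s≤s A≤t) (s≤s t≤C)
  with ⊆-between t (drop-∷-⊆ A⊆C) A≤t t≤C
... | S , A⊆S , S⊆C , size = true ∷ S , s⊆s A⊆S , s⊆s S⊆C , cong suc size
⊆-between {A = false ∷ A} {true ∷ C} t A⊆C A≤t t≤1+C with t ≤? ∣ C ∣
... | yes t≤C = let S , A⊆S , S⊆C , size = ⊆-between t (drop-∷-⊆ A⊆C) A≤t t≤C in
                false ∷ S , s⊆s A⊆S , out⊆ S⊆C , size
... | no t≰C = true ∷ C , A⊆C , id , ≤-antisym (≰⇒> t≰C) t≤1+C

module _ {s n : ℕ} {H M : Graph n} (2≤s : 2 ≤ s)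
         (shared : ∀ {S} → ∣ S ∣ ≡ s → IsClique M S → IsClique H S) where

  large-clique-shared : ∀ {C} → s ≤ ∣ C ∣ → IsClique M C → IsClique H C
  large-clique-shared {C} s≤C clique {i} {j} i∈C j∈C i≢j =
    let S , ij⊆S , S⊆C , size = ⊆-between s ij⊆C ∣ij∣≤s s≤C in
    shared size (λ a∈S b∈S → clique (S⊆C a∈S) (S⊆C b∈S))
      (ij⊆S (x∈p∪q⁺ (inj₁ (x∈⁅x⁆ i)))) (ij⊆S (x∈p∪q⁺ (inj₂ (x∈⁅x⁆ j)))) i≢j
    where
    ij⊆C : ⁅ i ⁆ ∪ ⁅ j ⁆ ⊆ₛ C
    ij⊆C a∈ with x∈p∪q⁻ ⁅ i ⁆ ⁅ j ⁆ a∈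
    ... | inj₁ a∈i rewrite x∈⁅y⁆⇒x≡y i a∈i = i∈C
    ... | inj₂ a∈j rewrite x∈⁅y⁆⇒x≡y j a∈j = j∈C
    ∣ij∣≤s : ∣ ⁅ i ⁆ ∪ ⁅ j ⁆ ∣ ≤ s
    ∣ij∣≤s = begin
      ∣ ⁅ i ⁆ ∪ ⁅ j ⁆ ∣       ≤⟨ ∣p∪q∣≤∣p∣+∣q∣ ⁅ i ⁆ ⁅ j ⁆ ⟩
      ∣ ⁅ i ⁆ ∣ + ∣ ⁅ j ⁆ ∣  ≡⟨ cong₂ _+_ (∣⁅x⁆∣≡1 i) (∣⁅x⁆∣≡1 j) ⟩
      2                       ≤⟨ 2≤s ⟩
      s                       ∎
      where open ≤-Reasoning

preimage : ∀ {m n} → (Fin m → Fin n) → Subset n → Subset m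
preimage f S = Vec.tabulate (lookup S ∘ f)

module _ {m n} (f : Fin m → Fin n) (S : Subset n) where

  ∈-preimage⁻ : ∀ {i} → i ∈ₛ preimage f S → f i ∈ₛ S
  ∈-preimage⁻ {i} i∈ = lookup⇒[]= (f i) S (trans (sym (lookup∘tabulate (lookup S ∘ f) i)) ([]=⇒lookup i∈))

  ∈-preimage⁺ : ∀ {i} → f i ∈ₛ S → i ∈ₛ preimage f S
  ∈-preimage⁺ {i} fi∈ = lookup⇒[]= i (preimage f S) (trans (lookup∘tabulate (lookup S ∘ f) i) ([]=⇒lookup fi∈))

preimage-∘ : ∀ {l m n} (f : Fin m → Fin n) (g : Fin l → Fin m) (S : Subset n) →
             preimage g (preimage f S) ≡ preimage (f ∘ g) S
preimage-∘ f g S = tabulate-cong (lookup∘tabulate (lookup S ∘ f) ∘ g)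

private
  indicator : Bool → ℕ
  indicator b = if b then 1 else 0

∣p∣≡∑ : ∀ {n} (p : Subset n) → ∣ p ∣ ≡ Σ.sum (indicator ∘ lookup p)
∣p∣≡∑ [] = refl
∣p∣≡∑ (true ∷ p) = cong suc (∣p∣≡∑ p)
∣p∣≡∑ (false ∷ p) = ∣p∣≡∑ p

∣preimage∣ : ∀ {n} (π : Permutation n n) (S : Subset n) → ∣ preimage (π ⟨$⟩ʳ_) S ∣ ≡ ∣ S ∣
∣preimage∣ π S = begin
  ∣ preimage (π ⟨$⟩ʳ_) S ∣                           ≡⟨ ∣p∣≡∑ (preimage (π ⟨$⟩ʳ_) S) ⟩
  Σ.sum (indicator ∘ lookup (preimage (π ⟨$⟩ʳ_) S))  ≡⟨ Σ.sum-cong-≗ (cong indicator ∘ lookup∘tabulate Sπ) ⟩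
  Σ.sum (indicator ∘ lookup S ∘ (π ⟨$⟩ʳ_))           ≡⟨ Σ.sum-permute (indicator ∘ lookup S) π ⟨
  Σ.sum (indicator ∘ lookup S)                        ≡⟨ ∣p∣≡∑ S ⟨
  ∣ S ∣                                              ∎
  where
  open ≡-Reasoning
  Sπ = lookup S ∘ (π ⟨$⟩ʳ_)

module Isomorphism {n} {G H : Graph n} (G≅H : G ≅ H) where
  π = proj₁ G≅H
  open Inverse π public using (to; from; strictlyInverseˡ; strictlyInverseʳ)

  Adj-to : ∀ {i j} → Adj G i j → Adj H (to i) (to j)
  Adj-to {i} {j} ij = trans (proj₂ G≅H i j) ij

  Adj-from : ∀ {a b} → Adj H a b → Adj G (from a) (from b)
  Adj-from {a} {b} ab = trans (sym (proj₂ G≅H (from a) (from b)))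
                          (subst₂ (λ a′ b′ → Adj H a′ b′) (sym (strictlyInverseˡ a)) (sym (strictlyInverseˡ b)) ab)

  to-injective : ∀ {i j} → to i ≡ to j → i ≡ j
  to-injective {i} {j} e = trans (sym (strictlyInverseʳ i)) (trans (cong from e) (strictlyInverseʳ j))

  from-injective : ∀ {a b} → from a ≡ from b → a ≡ b
  from-injective {a} {b} e = trans (sym (strictlyInverseˡ a)) (trans (cong to e) (strictlyInverseˡ b))

  preimage-from-injective : ∀ {S S′} → preimage from S ≡ preimage from S′ → S ≡ S′
  preimage-from-injective {S} {S′} e = begin
    S                               ≡⟨ recover S ⟨
    preimage to (preimage from S)   ≡⟨ cong (preimage to) e ⟩
    preimage to (preimage from S′)  ≡⟨ recover S′ ⟩
    S′                              ∎
    where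
    open ≡-Reasoning
    recover : ∀ S → preimage to (preimage from S) ≡ S
    recover S = trans (preimage-∘ from to S)
                  (trans (tabulate-cong (cong (lookup S) ∘ strictlyInverseʳ)) (tabulate∘lookup S))

  clique-preimage : ∀ {S} → IsClique H S → IsClique G (preimage to S)
  clique-preimage {S} clique i∈ j∈ i≢j =
    trans (sym (proj₂ G≅H _ _)) (clique (∈-preimage⁻ to S i∈) (∈-preimage⁻ to S j∈) (i≢j ∘ to-injective))

  N-≅ : ∀ s → N s G ≤ N s H
  N-≅ s = N-mono s {A = G} {B = H} (preimage from) preimage-from-injective λ {S} size clique →
    trans (∣preimage∣ (flip π) S) size ,
    λ a∈ b∈ a≢b → subst₂ (Adj H) (strictlyInverseˡ _) (strictlyInverseˡ _)
      (Adj-to (clique (∈-preimage⁻ from S a∈) (∈-preimage⁻ from S b∈) (a≢b ∘ from-injective)))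

  CycleBound-≅ : ∀ {u v k} → CycleBound G u v k → CycleBound H (to u) (to v) k
  CycleBound-≅ {u} {v} {k} bound mid mid≢[] linked unique =
    subst (λ l → l + 2 ≤ k) (length-map from mid)
      (bound (map from mid) (mid≢[] ∘ map-≡[]) (subst (Linked (Adj G)) pulled-back (Linked.map⁺ (Linked.map Adj-from linked)))
             (subst Unique pulled-back (Unique.map⁺ from-injective unique)))
    where
    pulled-back : map from (to v ∷ mid ++ [ to u ]) ≡ v ∷ map from mid ++ [ u ]
    pulled-back = cong₂ _∷_ (strictlyInverseʳ v)
      (trans (map-++ from mid [ to u ]) (cong (λ z → map from mid ++ [ z ]) (strictlyInverseʳ u)))
    map-≡[] : ∀ {xs} → map from xs ≡ [] → xs ≡ []
    map-≡[] {[]} _ = refl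

∣p∷ʳoutside∣ : ∀ {n} (p : Subset n) → ∣ p Vec.∷ʳ false ∣ ≡ ∣ p ∣
∣p∷ʳoutside∣ [] = refl
∣p∷ʳoutside∣ (true ∷ p) = cong suc (∣p∷ʳoutside∣ p)
∣p∷ʳoutside∣ (false ∷ p) = ∣p∷ʳoutside∣ p

∈-∷ʳoutside⁻ : ∀ {n} {p : Subset n} {i} → i ∈ₛ p Vec.∷ʳ false → ∃ λ i′ → i ≡ inject₁ i′ × i′ ∈ₛ p
∈-∷ʳoutside⁻ {p = []} {zero} ()
∈-∷ʳoutside⁻ {p = b ∷ p} {zero} here = zero , refl , here
∈-∷ʳoutside⁻ {p = b ∷ p} {suc i} (there i∈) with ∈-∷ʳoutside⁻ i∈
... | i′ , refl , i′∈ = suc i′ , refl , there i′∈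

N-mono-inject₁ : ∀ s {m} {A : Graph m} {B : Graph (suc m)} →
                 (∀ i j → adj B (inject₁ i) (inject₁ j) ≡ adj A i j) → N s A ≤ N s B
N-mono-inject₁ s {A = A} {B} adj-inject₁ =
  N-mono s {A = A} {B = B} (Vec._∷ʳ false) (∷ʳ-injectiveˡ _ _) λ {S} size clique →
    trans (∣p∷ʳoutside∣ S) size , extended-clique clique
  where
  extended-clique : ∀ {S} → IsClique A S → IsClique B (S Vec.∷ʳ false)
  extended-clique clique i∈ j∈ i≢j with ∈-∷ʳoutside⁻ i∈ | ∈-∷ʳoutside⁻ j∈
  ... | i′ , refl , i′∈ | j′ , refl , j′∈ =
    trans (adj-inject₁ i′ j′) (clique i′∈ j′∈ (i≢j ∘ cong inject₁))

block-≡0 : ∀ k {t} → t < k → block k t ≡ 0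
block-≡0 k t<k = m<n⇒m/n≡0 (s≤s (∸-monoˡ-≤ 3 t<k))

block-≡0⁻ : ∀ {k t} → 3 ≤ k → block k t ≡ 0 → t < k
block-≡0⁻ {k} {t} 3≤k block≡0 = begin-strict
  t                 ≤⟨ m≤n+m∸n t 2 ⟩
  2 + (t ∸ 2)       <⟨ +-monoʳ-< 2 (m/n≡0⇒m<n block≡0) ⟩
  2 + suc (k ∸ 3)   ≡⟨ +-suc 2 (k ∸ 3) ⟩
  3 + (k ∸ 3)       ≡⟨ m+[n∸m]≡n 3≤k ⟩
  k                 ∎
  where open ≤-Reasoning

module _ {m k : ℕ} where

  X-adj-hub : ∀ {i j : Fin m} → toℕ i < 2 → i ≢ j → Adj (X m k) i j
  X-adj-hub {i} {j} i<2 i≢j with i ≟ j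
  ... | yes i≡j = contradiction i≡j i≢j
  ... | no _ rewrite Equivalence.to T-≡ (<⇒<ᵇ i<2) = refl

  X-adj-block : ∀ {i j : Fin m} → block k (toℕ i) ≡ block k (toℕ j) → i ≢ j → Adj (X m k) i j
  X-adj-block {i} {j} same i≢j with i ≟ j | block k (toℕ i) ℕ.≟ block k (toℕ j)
  ... | yes i≡j | _ = contradiction i≡j i≢j
  ... | no _ | no ¬same = contradiction same ¬same
  ... | no _ | yes _ rewrite ∨-zeroʳ (toℕ j <ᵇ 2) | ∨-zeroʳ (toℕ i <ᵇ 2) = refl

  X-adj⁻ : ∀ {i j : Fin m} → Adj (X m k) i j →
           toℕ i < 2 ⊎ toℕ j < 2 ⊎ block k (toℕ i) ≡ block k (toℕ j)
  X-adj⁻ {i} {j} ij with toℕ i <ᵇ 2 in i<2 | toℕ j <ᵇ 2 in j<2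
  ... | true | _ = inj₁ (<ᵇ⇒< _ _ (Equivalence.from T-≡ i<2))
  ... | false | true = inj₂ (inj₁ (<ᵇ⇒< _ _ (Equivalence.from T-≡ j<2)))
  ... | false | false with block k (toℕ i) ℕ.≟ block k (toℕ j) | block k (toℕ j) ℕ.≟ block k (toℕ i)
  ...   | yes same | _ = inj₂ (inj₂ same)
  ...   | no _ | yes same = inj₂ (inj₂ (sym same))
  ...   | no _ | no _ = contradiction (trans (sym ij) (∧-zeroʳ (not ⌊ i ≟ j ⌋))) λ ()

  X-adj-inject₁ : ∀ (i j : Fin m) → adj (X (suc m) k) (inject₁ i) (inject₁ j) ≡ adj (X m k) i j
  X-adj-inject₁ i j with i ≟ j | inject₁ i ≟ inject₁ j
  ... | yes _ | yes _ = refl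
  ... | no i≢j | yes i≡j = contradiction (inject₁-injective i≡j) i≢j
  ... | yes refl | no i≢i = contradiction refl i≢i
  ... | no _ | no _ rewrite toℕ-inject₁ i | toℕ-inject₁ j = refl

below : ∀ n → ℕ → Subset n
below zero _ = []
below (suc n) zero = false ∷ below n zero
below (suc n) (suc k) = true ∷ below n k

∈-below⁻ : ∀ {n k} {i : Fin n} → i ∈ₛ below n k → toℕ i < k
∈-below⁻ {suc n} {zero} {suc i} (there i∈) with ∈-below⁻ {n} {0} i∈
... | ()
∈-below⁻ {suc n} {suc k} {zero} here = s≤s z≤n
∈-below⁻ {suc n} {suc k} {suc i} (there i∈) = s≤s (∈-below⁻ i∈)

∈-below⁺ : ∀ {n k} {i : Fin n} → toℕ i < k → i ∈ₛ below n k
∈-below⁺ {suc n} {suc k} {zero} _ = here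
∈-below⁺ {suc n} {suc k} {suc i} (s≤s i<k) = there (∈-below⁺ i<k)

∣below∣ : ∀ {n k} → k ≤ n → ∣ below n k ∣ ≡ k
∣below∣ {n} {zero} _ = none n
  where
  none : ∀ n → ∣ below n zero ∣ ≡ 0
  none zero = refl
  none (suc n) = none n
∣below∣ {suc n} {suc k} (s≤s k≤n) = cong suc (∣below∣ k≤n)

below-list : ∀ {n k} → k ≤ n → List (Fin n)
below-list k≤n = tabulate (λ i → inject≤ i k≤n)

module _ {n k : ℕ} (k≤n : k ≤ n) where

  below-list-unique : Unique (below-list k≤n)
  below-list-unique = Unique.tabulate⁺ (inject≤-injective k≤n k≤n _ _)

  length-below-list : length (below-list k≤n) ≡ k
  length-below-list = length-tabulate _

  ∈-below-list⁻ : ∀ {z} → z ∈ below-list k≤n → toℕ z < k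
  ∈-below-list⁻ z∈ with ∈-tabulate⁻ z∈
  ... | i , refl = subst (_< k) (sym (toℕ-inject≤ i k≤n)) (toℕ<n i)

  ∈-below-list⁺ : ∀ {z} → toℕ z < k → z ∈ below-list k≤n
  ∈-below-list⁺ {z} z<k = subst (_∈ below-list k≤n) (toℕ-injective toℕ-equal) (∈-tabulate⁺ (fromℕ< z<k))
    where
    toℕ-equal : toℕ (inject≤ (fromℕ< z<k) k≤n) ≡ toℕ z
    toℕ-equal = trans (toℕ-inject≤ (fromℕ< z<k) k≤n) (toℕ-fromℕ< z<k)

module _ {m k : ℕ} where

  X-adj-low : ∀ {i j : Fin m} → toℕ i < k → toℕ j < k → i ≢ j → Adj (X m k) i j
  X-adj-low i<k j<k = X-adj-block {k = k} (trans (block-≡0 k i<k) (sym (block-≡0 k j<k)))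

  X-below-clique : IsClique (X m k) (below m k)
  X-below-clique i∈ j∈ = X-adj-low (∈-below⁻ i∈) (∈-below⁻ j∈)

  X-neighbour-low : ∀ {i j : Fin m} → 3 ≤ k → 2 ≤ toℕ i → toℕ i < k → Adj (X m k) i j → toℕ j < k
  X-neighbour-low 3≤k 2≤i i<k ij with X-adj⁻ {k = k} ij
  ... | inj₁ i<2 = contradiction 2≤i (<⇒≱ i<2)
  ... | inj₂ (inj₁ j<2) = <-≤-trans j<2 (≤-trans (n≤1+n 2) 3≤k)
  ... | inj₂ (inj₂ same) = block-≡0⁻ 3≤k (trans (sym same) (block-≡0 k i<k))

  -- The detour visits all of the first k vertices and, by the Any hypothesis, one more.
  X-no-long-detour :
    2 ≤ k → k ≤ m → ∀ {a b} → CycleBound (X m k) a b k →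
    ∀ P {c d} R → toℕ c < k → toℕ d < k →
    Linked (Adj (X m k)) (P ++ [ c ]) → Linked (Adj (X m k)) (d ∷ R) → Unique (P ++ c ∷ d ∷ R) →
    Any (λ z → k ≤ toℕ z) (P ++ c ∷ d ∷ R) →
    head (P ++ [ c ]) ≡ just b → last (d ∷ R) ≡ just a → ⊥
  X-no-long-detour 2≤k k≤m bound P {c} {d} R c<k d<k linkedP linkedR explicit! far headb lasta =
    <⇒≱ E<explicit (+-cancelˡ-≤ k _ _ detour)
    where
    explicit = P ++ c ∷ d ∷ R
    E = filter (λ z → toℕ z <? k) explicit
    detour : k + (length P + length R + 2) ≤ k + length E
    detour = subst (λ l → l + (length P + length R + 2) ≤ k + length E) (length-below-list k≤m)
      (detour-through-clique (X m k) (λ z → toℕ z < k) X-adj-low 2≤k bound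
        (below-list-unique k≤m) (All.tabulate (∈-below-list⁻ k≤m)) P R E c<k d<k linkedP linkedR explicit!
        (λ z∈T z∈explicit → ∈-filter⁺ (λ z → toℕ z <? k) z∈explicit (∈-below-list⁻ k≤m z∈T)) headb lasta)
    E<explicit : length E < length P + length R + 2
    E<explicit = subst (length E <_) (trans (length-++ P) (sym (+-suc-suc (length P) (length R))))
      (filter-notAll (λ z → toℕ z <? k) explicit (Any.map ≤⇒≯ far))
      where
      +-suc-suc : ∀ p r → p + r + 2 ≡ p + suc (suc r)
      +-suc-suc = solve-∀

<2-distinct : ∀ {a b c} → a < 2 → b < 2 → c < 2 → a ≢ b → c ≢ a → c ≢ b → ⊥
<2-distinct {0} {0} _ _ _ a≢b _ _ = a≢b refl
<2-distinct {1} {1} _ _ _ a≢b _ _ = a≢b refl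
<2-distinct {0} {1} {0} _ _ _ _ c≢a _ = c≢a refl
<2-distinct {1} {0} {1} _ _ _ _ c≢a _ = c≢a refl
<2-distinct {0} {1} {1} _ _ _ _ _ c≢b = c≢b refl
<2-distinct {1} {0} {0} _ _ _ _ _ c≢b = c≢b refl
<2-distinct {suc (suc _)} (s≤s (s≤s ()))
<2-distinct {b = suc (suc _)} _ (s≤s (s≤s ()))
<2-distinct {c = suc (suc _)} _ _ (s≤s (s≤s ()))

below-2-pigeonhole : ∀ {n} {p q r : Fin n} → toℕ p < 2 → toℕ q < 2 → toℕ r < 2 → p ≢ q → r ≡ p ⊎ r ≡ q
below-2-pigeonhole {p = p} {q} {r} p<2 q<2 r<2 p≢q with toℕ r ℕ.≟ toℕ p | toℕ r ℕ.≟ toℕ q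
... | yes r≡p | _ = inj₁ (toℕ-injective r≡p)
... | no _ | yes r≡q = inj₂ (toℕ-injective r≡q)
... | no r≢p | no r≢q = ⊥-elim (<2-distinct p<2 q<2 r<2 (p≢q ∘ toℕ-injective) r≢p r≢q)

module XHubs {m k : ℕ} (3≤k : 3 ≤ k) (k<m : k < m) where

  private
    2≤k : 2 ≤ k
    2≤k = ≤-trans (n≤1+n 2) 3≤k

    k≤m : k ≤ m
    k≤m = <⇒≤ k<m

    hub<k : ∀ {i : Fin m} → toℕ i < 2 → toℕ i < k
    hub<k i<2 = <-≤-trans i<2 2≤k

    separated : ∀ {i j : Fin m} {t} → toℕ i < t → t ≤ toℕ j → i ≢ j
    separated i<t t≤j refl = <⇒≱ i<t t≤j

    hub-adj : ∀ {i j : Fin m} → toℕ i < 2 → i ≢ j → Adj (X m k) i j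
    hub-adj = X-adj-hub {k = k}

    adj-hub : ∀ {i j : Fin m} → toℕ j < 2 → i ≢ j → Adj (X m k) i j
    adj-hub {i} {j} j<2 i≢j = Adj-sym (X m k) {j} {i} (hub-adj j<2 (≢-sym i≢j))

    hub₀ hub₁ far₀ : Fin m
    hub₀ = fromℕ< (≤-trans (s≤s z≤n) k<m)
    hub₁ = fromℕ< (≤-trans 2≤k k≤m)
    far₀ = fromℕ< k<m

    hub₀<2 : toℕ hub₀ < 2
    hub₀<2 = subst (_< 2) (sym (toℕ-fromℕ< _)) (s≤s z≤n)

    hub₁<2 : toℕ hub₁ < 2
    hub₁<2 = subst (_< 2) (sym (toℕ-fromℕ< _)) (s≤s (s≤s z≤n))

    hub₀≢hub₁ : hub₀ ≢ hub₁
    hub₀≢hub₁ = separated (subst (_< 1) (sym (toℕ-fromℕ< _)) (s≤s z≤n)) (≤-reflexive (sym (toℕ-fromℕ< _)))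

    k≤far₀ : k ≤ toℕ far₀
    k≤far₀ = ≤-reflexive (sym (toℕ-fromℕ< k<m))

    other-hub : ∀ {a : Fin m} → toℕ a < 2 → ∃ λ a′ → toℕ a′ < 2 × a′ ≢ a
    other-hub {a} _ with a ≟ hub₀
    ... | yes refl = hub₁ , hub₁<2 , ≢-sym hub₀≢hub₁
    ... | no a≢hub₀ = hub₀ , hub₀<2 , ≢-sym a≢hub₀

  -- hub: the K₂ of X; core: the rest of the first block; far: the later blocks.
  data Zone (i : Fin m) : Set where
    hub  : toℕ i < 2 → Zone i
    core : 2 ≤ toℕ i → toℕ i < k → Zone i
    far  : k ≤ toℕ i → Zone i

  zone : ∀ i → Zone i
  zone i with toℕ i <? 2 | toℕ i <? k
  ... | yes i<2 | _ = hub i<2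
  ... | no i≮2 | yes i<k = core (≮⇒≥ i≮2) i<k
  ... | no _ | no i≮k = far (≮⇒≥ i≮k)

  private
    no-long-detour = X-no-long-detour {m} {k} 2≤k k≤m

    hub-core : ∀ {a b} → toℕ a < 2 → 2 ≤ toℕ b → toℕ b < k → ¬ CycleBound (X m k) a b k
    hub-core {a} {b} a<2 2≤b b<k bound =
      let a′ , a′<2 , a′≢a = other-hub a<2
          a′≢far₀ = separated (hub<k a′<2) k≤far₀
          far₀≢a = ≢-sym (separated (hub<k a<2) k≤far₀)
      in no-long-detour bound [] (far₀ ∷ a ∷ []) b<k (hub<k a′<2)
           [-] (hub-adj a′<2 a′≢far₀ ∷ adj-hub a<2 far₀≢a ∷ [-])
           ((≢-sym (separated a′<2 2≤b) ∷ separated b<k k≤far₀ ∷ ≢-sym (separated a<2 2≤b) ∷ []) ∷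
            (a′≢far₀ ∷ a′≢a ∷ []) ∷ (far₀≢a ∷ []) ∷ [] ∷ [])
           (there (there (here k≤far₀))) refl refl

    hub-far : ∀ {a b} → toℕ a < 2 → k ≤ toℕ b → ¬ CycleBound (X m k) a b k
    hub-far {a} {b} a<2 k≤b bound =
      let a′ , a′<2 , a′≢a = other-hub a<2
          b≢a′ = ≢-sym (separated (hub<k a′<2) k≤b)
      in no-long-detour bound (b ∷ []) [] (hub<k a′<2) (hub<k a<2)
           (adj-hub a′<2 b≢a′ ∷ [-]) [-]
           ((b≢a′ ∷ ≢-sym (separated (hub<k a<2) k≤b) ∷ []) ∷ (a′≢a ∷ []) ∷ [] ∷ [])
           (here k≤b) refl refl

    core-hub : ∀ {a b} → 2 ≤ toℕ a → toℕ a < k → toℕ b < 2 → ¬ CycleBound (X m k) a b k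
    core-hub {a} {b} 2≤a a<k b<2 bound =
      let b′ , b′<2 , b′≢b = other-hub b<2
          b≢far₀ = separated (hub<k b<2) k≤far₀
          far₀≢b′ = ≢-sym (separated (hub<k b′<2) k≤far₀)
      in no-long-detour bound (b ∷ far₀ ∷ []) [] (hub<k b′<2) a<k
           (hub-adj b<2 b≢far₀ ∷ adj-hub b′<2 far₀≢b′ ∷ [-]) [-]
           ((b≢far₀ ∷ ≢-sym b′≢b ∷ separated b<2 2≤a ∷ []) ∷
            (far₀≢b′ ∷ ≢-sym (separated a<k k≤far₀) ∷ []) ∷ (separated b′<2 2≤a ∷ []) ∷ [] ∷ [])
           (there (here k≤far₀)) refl refl

    far-hub : ∀ {a b} → k ≤ toℕ a → toℕ b < 2 → ¬ CycleBound (X m k) a b k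
    far-hub {a} {b} k≤a b<2 bound =
      let b′ , b′<2 , b′≢b = other-hub b<2
          b′≢a = separated (hub<k b′<2) k≤a
      in no-long-detour bound [] (a ∷ []) (hub<k b<2) (hub<k b′<2)
           [-] (hub-adj b′<2 b′≢a ∷ [-])
           ((≢-sym b′≢b ∷ separated (hub<k b<2) k≤a ∷ []) ∷ (b′≢a ∷ []) ∷ [] ∷ [])
           (there (there (here k≤a))) refl refl

    core-core : ∀ {a b} → a ≢ b → 2 ≤ toℕ a → toℕ a < k → 2 ≤ toℕ b → toℕ b < k →
                ¬ CycleBound (X m k) a b k
    core-core {a} {b} a≢b 2≤a a<k 2≤b b<k bound =
      let b≢hub₀ = ≢-sym (separated hub₀<2 2≤b)
          hub₀≢far₀ = separated (hub<k hub₀<2) k≤far₀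
          far₀≢hub₁ = ≢-sym (separated (hub<k hub₁<2) k≤far₀)
      in no-long-detour bound (b ∷ hub₀ ∷ far₀ ∷ []) [] (hub<k hub₁<2) a<k
           (adj-hub hub₀<2 b≢hub₀ ∷ hub-adj hub₀<2 hub₀≢far₀ ∷ adj-hub hub₁<2 far₀≢hub₁ ∷ [-]) [-]
           ((b≢hub₀ ∷ separated b<k k≤far₀ ∷ ≢-sym (separated hub₁<2 2≤b) ∷ ≢-sym a≢b ∷ []) ∷
            (hub₀≢far₀ ∷ hub₀≢hub₁ ∷ separated hub₀<2 2≤a ∷ []) ∷
            (far₀≢hub₁ ∷ ≢-sym (separated a<k k≤far₀) ∷ []) ∷
            (separated hub₁<2 2≤a ∷ []) ∷ [] ∷ [])
           (there (there (here k≤far₀))) refl refl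

    far-far : ∀ {a b} → a ≢ b → k ≤ toℕ a → k ≤ toℕ b → ¬ CycleBound (X m k) a b k
    far-far {a} {b} a≢b k≤a k≤b bound =
      let b≢hub₀ = ≢-sym (separated (hub<k hub₀<2) k≤b)
          hub₁≢a = separated (hub<k hub₁<2) k≤a
      in no-long-detour bound (b ∷ []) (a ∷ []) (hub<k hub₀<2) (hub<k hub₁<2)
           (adj-hub hub₀<2 b≢hub₀ ∷ [-]) (hub-adj hub₁<2 hub₁≢a ∷ [-])
           ((b≢hub₀ ∷ ≢-sym (separated (hub<k hub₁<2) k≤b) ∷ ≢-sym a≢b ∷ []) ∷
            (hub₀≢hub₁ ∷ separated (hub<k hub₀<2) k≤a ∷ []) ∷ (hub₁≢a ∷ []) ∷ [] ∷ [])
           (here k≤b) refl refl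

  CycleBound⇒hubs : ∀ {a b : Fin m} → Adj (X m k) a b → CycleBound (X m k) a b k → toℕ a < 2 × toℕ b < 2
  CycleBound⇒hubs {a} {b} ab bound with zone a | zone b
  ... | hub a<2      | hub b<2      = a<2 , b<2
  ... | hub a<2      | core 2≤b b<k = ⊥-elim (hub-core a<2 2≤b b<k bound)
  ... | hub a<2      | far k≤b      = ⊥-elim (hub-far a<2 k≤b bound)
  ... | core 2≤a a<k | hub b<2      = ⊥-elim (core-hub 2≤a a<k b<2 bound)
  ... | far k≤a      | hub b<2      = ⊥-elim (far-hub k≤a b<2 bound)
  ... | core 2≤a a<k | core 2≤b b<k = ⊥-elim (core-core (Adj⇒≢ (X m k) ab) 2≤a a<k 2≤b b<k bound)
  ... | far k≤a      | far k≤b      = ⊥-elim (far-far (Adj⇒≢ (X m k) ab) k≤a k≤b bound)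
  ... | core 2≤a a<k | far k≤b      = contradiction (X-neighbour-low 3≤k 2≤a a<k ab) (≤⇒≯ k≤b)
  ... | far k≤a      | core 2≤b b<k = contradiction (X-neighbour-low 3≤k 2≤b b<k (Adj-sym (X m k) {a} {b} ab)) (≤⇒≯ k≤a)

module Contraction {m : ℕ} (G : Graph (suc m)) (x : Fin (suc m)) (u′ : Fin m) where

  private
    H = Contract G (punchIn x u′) x

  Adj-contract⁺ : ∀ {i j} → Adj G (punchIn x i) (punchIn x j) → Adj H i j
  Adj-contract⁺ {i} {j} ij with i ≟ j
  ... | yes refl = contradiction refl (Adj⇒≢ G ij)
  ... | no _ rewrite ij = refl

  Adj-contract⁻ : ∀ {i j} → i ≢ u′ → j ≢ u′ → Adj H i j → Adj G (punchIn x i) (punchIn x j)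
  Adj-contract⁻ {i} {j} i≢u′ j≢u′ ij
    with i ≟ j | punchIn x i ≟ punchIn x u′ | punchIn x j ≟ punchIn x u′
  ... | yes _ | _ | _ = contradiction ij λ ()
  ... | no _ | yes e | _ = contradiction (punchIn-injective x i u′ e) i≢u′
  ... | no _ | no _ | yes e = contradiction (punchIn-injective x j u′ e) j≢u′
  ... | no _ | no _ | no _ with adj G (punchIn x i) (punchIn x j) in ij′ | adj G (punchIn x j) (punchIn x i) in ji′
  ...   | true | _ = refl
  ...   | false | true = contradiction (trans (sym ij′) (trans (Graph.sym G _ _) ji′)) λ ()
  ...   | false | false = contradiction ij λ ()

module _ {s m k : ℕ} {H M : Graph m} (2≤s : 2 ≤ s) (s≤k : s ≤ k) (k≤m : k ≤ m)
         (H⊆M : SpanningSub H M) (M≅X : M ≅ X m k) where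
  open Isomorphism {G = M} {H = X m k} M≅X

  low-clique-inherited : g s (suc m) k ≤ N s H → IsClique H (preimage to (below m k))
  low-clique-inherited g≤H =
    large-clique-shared {H = H} {M = M} 2≤s (spanning-cliques-shared s {H = H} {M = M} H⊆M M≤H) s≤low
      (clique-preimage (X-below-clique {k = k}))
    where
    open ≤-Reasoning
    M≤H : N s M ≤ N s H
    M≤H = begin
      N s M              ≤⟨ N-≅ s ⟩
      N s (X m k)        ≤⟨ N-mono-inject₁ s {A = X m k} {B = X (suc m) k} (X-adj-inject₁ {k = k}) ⟩
      g s (suc m) k      ≤⟨ g≤H ⟩
      N s H              ∎
    s≤low : s ≤ ∣ preimage to (below m k) ∣
    s≤low = begin
      s                              ≤⟨ s≤k ⟩
      k                              ≡⟨ ∣below∣ k≤m ⟨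
      ∣ below m k ∣                  ≡⟨ ∣preimage∣ π (below m k) ⟨
      ∣ preimage to (below m k) ∣    ∎

module _ {m k : ℕ} (G : Graph (suc m)) (x : Fin (suc m)) {u′ v′ : Fin m} (2≤k : 2 ≤ k)
         (bound : CycleBound G (punchIn x u′) (punchIn x v′) k) (ux : Adj G (punchIn x u′) x)
         {K : List (Fin m)} (K! : Unique K) (k≤K : k ≤ length K)
         (K-clique : ∀ {i j} → i ∈ K → j ∈ K → i ≢ u′ → j ≢ u′ → i ≢ j → Adj G (punchIn x i) (punchIn x j))
  where
  open Difference (_≟_ {m})

  private
    pI = punchIn x

    InK : Fin (suc m) → Set
    InK c = ∃ λ z → z ∈ K × z ≢ u′ × pI z ≡ c

    InK-clique : ∀ {a b} → InK a → InK b → a ≢ b → Adj G a b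
    InK-clique (i , i∈ , i≢u′ , refl) (j , j∈ , j≢u′ , refl) pi≢pj = K-clique i∈ j∈ i≢u′ j≢u′ (pi≢pj ∘ cong pI)

  x-no-clique-neighbour : v′ ∈ K → v′ ≢ u′ → ∀ {y} → y ∈ K → y ≢ u′ → y ≢ v′ → ¬ Adj G x (pI y)
  x-no-clique-neighbour v′∈ v′≢u′ {y} y∈ y≢u′ y≢v′ xy = <⇒≱ (n<1+n 2) (+-cancelˡ-≤ k 3 2 (begin
      k + 3                           ≤⟨ +-monoˡ-≤ 3 k≤K ⟩
      length K + 3                    ≤⟨ +-monoˡ-≤ 3 (length-∖ (u′ ∷ []) K!) ⟩
      length (K ∖ (u′ ∷ [])) + 1 + 3  ≡⟨ +-assoc _ 1 3 ⟩
      length (K ∖ (u′ ∷ [])) + 4      ≡⟨ cong (_+ 4) (length-map pI (K ∖ (u′ ∷ []))) ⟨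
      length image + 4                ≤⟨ detour ⟩
      k + 2                           ∎))
    where
    open ≤-Reasoning
    image = map pI (K ∖ (u′ ∷ []))
    pI≢x : ∀ z → pI z ≢ x
    pI≢x = punchInᵢ≢i x
    pI≢pI : ∀ {i j} → i ≢ j → pI i ≢ pI j
    pI≢pI i≢j = i≢j ∘ punchIn-injective x _ _
    image-InK : ∀ {c} → c ∈ image → InK c
    image-InK c∈ with ∈-map⁻ pI c∈
    ... | z , z∈ , refl = let z∈K , z∉u′ = ∈-∖⁻ K (u′ ∷ []) z∈ in z , z∈K , z∉u′ ∘ here , refl
    detour : length image + 4 ≤ k + 2
    detour = detour-through-clique G InK InK-clique 2≤k bound
      (Unique.map⁺ (punchIn-injective x _ _) (∖-unique (u′ ∷ []) K!)) (All.tabulate image-InK)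
      [] (x ∷ pI u′ ∷ []) (pI v′ ∷ pI y ∷ [])
      (v′ , v′∈ , v′≢u′ , refl) (y , y∈ , y≢u′ , refl)
      [-] (Adj-sym G xy ∷ Adj-sym G ux ∷ [-])
      ((pI≢pI (≢-sym y≢v′) ∷ pI≢x v′ ∷ pI≢pI v′≢u′ ∷ []) ∷ (pI≢x y ∷ pI≢pI y≢u′ ∷ []) ∷
       (≢-sym (pI≢x u′) ∷ []) ∷ [] ∷ [])
      explicit∩image refl refl
      where
      explicit∩image : ∀ {c} → c ∈ image → c ∈ pI v′ ∷ pI y ∷ x ∷ pI u′ ∷ [] → c ∈ pI v′ ∷ pI y ∷ []
      explicit∩image c∈image (here refl) = here refl
      explicit∩image c∈image (there (here refl)) = there (here refl)
      explicit∩image c∈image (there (there (here refl))) with image-InK c∈image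
      ... | z , _ , _ , pz≡x = contradiction pz≡x (pI≢x z)
      explicit∩image c∈image (there (there (there (here refl)))) with image-InK c∈image
      ... | z , _ , z≢u′ , pz≡pu′ = contradiction (punchIn-injective x z u′ pz≡pu′) z≢u′

module ContractionOntoX {k s m : ℕ} (3≤s : 3 ≤ s) (s≤k : s ≤ k) (k≤m : k ≤ m)
  (G : Graph (suc m)) (x : Fin (suc m)) (u′ v′ : Fin m)
  (uv : Adj G (punchIn x u′) (punchIn x v′)) (ux : Adj G (punchIn x u′) x)
  (boundG : CycleBound G (punchIn x u′) (punchIn x v′) k)
  (g≤H : g s (suc m) k ≤ N s (Contract G (punchIn x u′) x))
  {M : Graph m} (H⊆M : SpanningSub (Contract G (punchIn x u′) x) M) (M≅X : M ≅ X m k)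
  where

  open Isomorphism {G = M} {H = X m k} M≅X
  open Contraction G x u′

  private
    pI = punchIn x
    H = Contract G (pI u′) x

    3≤k : 3 ≤ k
    3≤k = ≤-trans 3≤s s≤k

    Low : Fin m → Set
    Low z = toℕ (to z) < k

    K : List (Fin m)
    K = map from (below-list k≤m)

    ∈-K⁺ : ∀ {z} → Low z → z ∈ K
    ∈-K⁺ {z} low = subst (_∈ K) (strictlyInverseʳ z) (∈-map⁺ from (∈-below-list⁺ k≤m low))

    ∈-K⁻ : ∀ {z} → z ∈ K → Low z
    ∈-K⁻ z∈ with ∈-map⁻ from z∈
    ... | p , p∈ , refl = subst (_< k) (sym (cong toℕ (strictlyInverseˡ p))) (∈-below-list⁻ k≤m p∈)

    low-adjacent : ∀ {i j} → i ∈ K → j ∈ K → i ≢ u′ → j ≢ u′ → i ≢ j → Adj G (pI i) (pI j)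
    low-adjacent {i} {j} i∈ j∈ i≢u′ j≢u′ i≢j = Adj-contract⁻ {i} {j} i≢u′ j≢u′
      (low-clique-inherited {H = H} {M = M} (≤-trans (n≤1+n 2) 3≤s) s≤k k≤m H⊆M M≅X g≤H
        (∈-preimage⁺ to (below m k) (∈-below⁺ (∈-K⁻ i∈)))
        (∈-preimage⁺ to (below m k) (∈-below⁺ (∈-K⁻ j∈))) i≢j)

    v′≢u′ : v′ ≢ u′
    v′≢u′ v′≡u′ = Adj⇒≢ G uv (cong pI (sym v′≡u′))

  x-no-low-neighbour : Low v′ → ∀ {y} → Low y → y ≢ u′ → y ≢ v′ → ¬ Adj G x (pI y)
  x-no-low-neighbour low-v′ low-y = x-no-clique-neighbour G x (≤-trans (n≤1+n 2) 3≤k) boundG ux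
    (Unique.map⁺ from-injective (below-list-unique k≤m))
    (≤-reflexive (sym (trans (length-map from (below-list k≤m)) (length-below-list k≤m))))
    low-adjacent (∈-K⁺ low-v′) v′≢u′ (∈-K⁺ low-y)

  all-low-impossible : (∀ z → Low z) → TwoConnected G → pI v′ ≢ x →
                       (∀ w → Adj G (pI u′) w → Adj G x w → ⊥) → ⊥
  all-low-impossible all-low (_ , connected) v≢x no-common
    with Reach⇒neighbour G (connected (pI u′) x (pI v′) (≢-sym (Adj⇒≢ G ux)) (v′≢u′ ∘ punchIn-injective x _ _))
                           (≢-sym v≢x)
  ... | c , xc , c≢u = x-no-low-neighbour (all-low v′) (all-low y) y≢u′ y≢v′ xy
    where
    x≢c = Adj⇒≢ G xc
    y = punchOut x≢c
    pIy≡c : pI y ≡ c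
    pIy≡c = punchIn-punchOut x≢c
    xy : Adj G x (pI y)
    xy = subst (Adj G x) (sym pIy≡c) xc
    y≢u′ : y ≢ u′
    y≢u′ y≡u′ = c≢u (trans (sym pIy≡c) (cong pI y≡u′))
    y≢v′ : y ≢ v′
    y≢v′ refl = no-common (pI v′) uv xy

  -- The core vertices of X, pulled back to G, are closed under neighbours outside {u,v}.
  uv-separates : k < m → CycleBound M u′ v′ k → pI v′ ≢ x → IsVertexCut2 G (pI u′) (pI v′)
  uv-separates k<m boundM v≢x =
    pI c₀ , x , pI-core≢hub c₀-core u′-hub , pI-core≢hub c₀-core v′-hub , ≢-sym (Adj⇒≢ G ux) , ≢-sym v≢x ,
    λ reach → let z , _ , pIz≡x = Reach-invariant G Inside closed reach (c₀ , c₀-core , refl) in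
              punchInᵢ≢i x z pIz≡x
    where
    hubs : toℕ (to u′) < 2 × toℕ (to v′) < 2
    hubs = XHubs.CycleBound⇒hubs 3≤k k<m (Adj-to (H⊆M _ _ (Adj-contract⁺ uv))) (CycleBound-≅ boundM)

    u′-hub = proj₁ hubs
    v′-hub = proj₂ hubs

    Core : Fin m → Set
    Core z = 2 ≤ toℕ (to z) × toℕ (to z) < k

    pI-core≢hub : ∀ {z w} → Core z → toℕ (to w) < 2 → pI z ≢ pI w
    pI-core≢hub (2≤z , _) w<2 pIz≡pIw rewrite punchIn-injective x _ _ pIz≡pIw = <⇒≱ w<2 2≤z

    c₀ : Fin m
    c₀ = from (fromℕ< (<-≤-trans (s≤s (s≤s (s≤s z≤n))) (≤-trans 3≤k k≤m)))

    c₀-core : Core c₀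
    c₀-core = subst (λ t → 2 ≤ t × t < k) (sym (trans (cong toℕ (strictlyInverseˡ _)) (toℕ-fromℕ< _)))
                (≤-refl , 3≤k)

    Inside : Fin (suc m) → Set
    Inside c = ∃ λ z → Core z × pI z ≡ c

    closed : ∀ {c d} → Inside c → Adj G c d → d ≢ pI u′ × d ≢ pI v′ → Inside d
    closed {d = d} (z , core , refl) zd (d≢u , d≢v) with x ≟ d
    ... | yes refl = ⊥-elim (x-no-low-neighbour (<-≤-trans v′-hub (≤-trans (n≤1+n 2) 3≤k)) (proj₂ core)
                       (pI-core≢hub core u′-hub ∘ cong pI) (pI-core≢hub core v′-hub ∘ cong pI) (Adj-sym G zd))
    ... | no x≢d = z′ , (z′-not-hub , z′-low) , pIz′≡d
      where
      z′ = punchOut x≢d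
      pIz′≡d : pI z′ ≡ d
      pIz′≡d = punchIn-punchOut x≢d
      z′-low : toℕ (to z′) < k
      z′-low = X-neighbour-low 3≤k (proj₁ core) (proj₂ core)
                 (Adj-to (H⊆M _ _ (Adj-contract⁺ (subst (Adj G (pI z)) (sym pIz′≡d) zd))))
      z′-not-hub : 2 ≤ toℕ (to z′)
      z′-not-hub with toℕ (to z′) <? 2
      ... | no z′≮2 = ≮⇒≥ z′≮2
      ... | yes z′<2 with below-2-pigeonhole u′-hub v′-hub z′<2 (v′≢u′ ∘ sym ∘ to-injective)
      ...   | inj₁ z′≡u′ = contradiction (trans (sym pIz′≡d) (cong pI (to-injective z′≡u′))) (≢-sym d≢u ∘ sym)
      ...   | inj₂ z′≡v′ = contradiction (trans (sym pIz′≡d) (cong pI (to-injective z′≡v′))) (≢-sym d≢v ∘ sym)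

  uv-cut : TwoConnected G → pI v′ ≢ x → (∀ w → Adj G (pI u′) w → Adj G x w → ⊥) →
           CycleBound M u′ v′ k → IsVertexCut2 G (pI u′) (pI v′)
  uv-cut two-connected v≢x no-common boundM with m≤n⇒m<n∨m≡n k≤m
  ... | inj₁ k<m = uv-separates k<m boundM v≢x
  ... | inj₂ k≡m = ⊥-elim (all-low-impossible (λ z → subst (toℕ (to z) <_) (sym k≡m) (toℕ<n (to z)))
                             two-connected v≢x no-common)

lemma9 : (k s m : ℕ) → 3 ≤ s → s ≤ k → k + 1 ≤ suc m →
         (G : Graph (suc m)) → TwoConnected G →
         N s G ≡ g s (suc m) k →
         (u v x : Fin (suc m)) → Adj G u v → Adj G u x → v ≢ x →
         CycleBound G u v k →
         (∀ w → Adj G u w → Adj G x w → ⊥) →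
         (u′ v′ : Fin m) → punchIn x u′ ≡ u → punchIn x v′ ≡ v →
         N s (Contract G u x) ≡ N s G →
         (M : Graph m) → EdgeMaximal (Contract G u x) u′ v′ k M →
         M ≅ X m k →
         IsVertexCut2 G u v
lemma9 k s m 3≤s s≤k k+1≤1+m G two-connected NG≡g _ _ x uv ux v≢x boundG no-common u′ v′ refl refl NH≡NG
       M (H⊆M , boundM , _) M≅X =
  ContractionOntoX.uv-cut 3≤s s≤k k≤m G x u′ v′ uv ux boundG g≤NH {M = M} H⊆M M≅X two-connected v≢x no-common boundM
  where
  k≤m : k ≤ m
  k≤m = ℕ.s≤s⁻¹ (subst (_≤ suc m) (+-comm k 1) k+1≤1+m)
  g≤NH : g s (suc m) k ≤ N s (Contract G (punchIn x u′) x)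
  g≤NH = ≤-reflexive (sym (trans NH≡NG NG≡g))
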